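{- Let $S[1..n]$ be a string and $k\geq1$. The marker graph $\mathcal G_{S,k}=\langle\mathcal C,\mathcal U,E\rangle$ satisfies $|\mathcal G_{S,k}|\in\mathcal O(|E|)\subseteq\mathcal O(|\mathcal C|\cdot\min\{k^2,|\mathcal U|\})$.
   Context: For an edge $e=\langle u,v\rangle$ of the suffix tree of $S$, $s(e)$ is the string read from the root to the first character of the label of $e$ and $\lambda(e)=|s(e)|$; a position $j$ marks $e$ if there is an occurrence $S[i..i+\lambda(e)-1]=s(e)$ with $i\leq j<i+\lambda(e)$. $\mathcal U$ is the set of suffix-tree edges $e$ with $\lambda(e)\leq k$ (the edges of the $k$-truncated suffix tree). Positions $i,j\in[1..n]$ satisfy $i\equiv_k j$ iff $S''[i-k+1..i+k-1]=S''[j-k+1..j+k-1]$, where $S''[p]=\#$ (not in the alphabet) if $p<1$ or $p>n$ and $S''[p]=S[p]$ otherwise; $\mathcal C=\{\min(I): I\in[1..n]/\equiv_k\}$. The marker graph is the bipartite undirected graph with vertex sets $\mathcal C$ and $\mathcal U$ and edge set $E=\{\langle j,e\rangle\in\mathcal C\times\mathcal U : j \text{ marks } e\}$; $|\mathcal G_{S,k}|$ denotes its size (vertices plus edges). -}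

module Defs where

open import Data.Nat using (ℕ; zero; suc; _+_; _*_; _∸_; _≤_; _<_; _<ᵇ_)
open import Data.Bool using (if_then_else_)
open import Data.List using (List; []; _∷_; _++_; [_]; length; take; drop)
open import Data.List.Membership.Propositional using (_∈_)
open import Data.List.Relation.Unary.Unique.Propositional using (Unique)
open import Data.Maybe using (Maybe; just; nothing)
open import Data.Product using (Σ; ∃; ∃-syntax; _×_; _,_)
open import Data.Sum using (_⊎_)
open import Relation.Binary.PropositionalEquality using (_≡_; _≢_)
open import Relation.Nullary using (¬_)
open import Function.Bundles using (_⇔_)

-- Conventions: the string S[1..n] is a list of length n; paper position p
-- (1 ≤ p ≤ n) is list index p - 1 (0-based).

Occ : {A : Set} → List A → List A → ℕ → Set
Occ S w i = (i + length w ≤ length S) × (take (length w) (drop i S) ≡ w)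

OccursIn : {A : Set} → List A → List A → Set
OccursIn S w = ∃[ i ] Occ S w i

RightBranching : {A : Set} → List A → List A → Set
RightBranching S x = ∃[ c ] ∃[ d ] (c ≢ d × OccursIn S (x ++ [ c ]) × OccursIn S (x ++ [ d ]))

-- Strings spelling the internal (branching) nodes of the suffix tree of S:
-- the root (empty string) and the right-branching substrings.
Node : {A : Set} → List A → List A → Set
Node S x = (x ≡ []) ⊎ RightBranching S x

-- An edge e = ⟨u,v⟩ of the suffix tree is identified by s(e) = str(u) · c,
-- where c is the first character of the label of e; such edges are exactly
-- the strings x · c with x a node string and x · c occurring in S.
-- λ(e) = |s(e)|.
EdgeString : {A : Set} → List A → List A → Set
EdgeString S w = ∃[ x ] ∃[ c ] ((w ≡ x ++ [ c ]) × Node S x × OccursIn S w)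

InU : {A : Set} → List A → ℕ → List A → Set
InU S k w = EdgeString S w × (length w ≤ k)

Marks : {A : Set} → List A → ℕ → List A → Set
Marks S j w = ∃[ i ] (Occ S w i × i ≤ j × j < i + length w)

charAt : {A : Set} → List A → ℕ → Maybe A
charAt []       _       = nothing
charAt (a ∷ S)  zero    = just a
charAt (a ∷ S)  (suc m) = charAt S m

-- padded S k m = S''[m - (k-1)] in 0-based indexing (nothing = #).
padded : {A : Set} → List A → ℕ → ℕ → Maybe A
padded S k m = if m <ᵇ (k ∸ 1) then nothing else charAt S (m ∸ (k ∸ 1))

-- i ≡_k j : the windows of S'' of radius k-1 around i and j coincide.
EquivK : {A : Set} → List A → ℕ → ℕ → ℕ → Set
EquivK S k i j = ∀ t → t < (k + k) ∸ 1 → padded S k (i + t) ≡ padded S k (j + t)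

InC : {A : Set} → List A → ℕ → ℕ → Set
InC S k j = (j < length S) × (∀ i → i < j → ¬ EquivK S k i j)

InE : {A : Set} → List A → ℕ → (ℕ × List A) → Set
InE S k (j , w) = InC S k j × InU S k w × Marks S j w

HasSize : {X : Set} → (X → Set) → ℕ → Set
HasSize {X} P m = Σ (List X) λ xs → Unique xs × (length xs ≡ m) × (∀ x → P x ⇔ (x ∈ xs))

{-# OPTIONS --safe #-}
-- Every j ∈ 𝒞 marks the one-character edge S[j], and an edge e ∈ 𝒰 occurring at i is
-- marked by the least position j of the ≡ₖ-class of i: the windows around j and i agree,
-- so s(e), of length ≤ k, also occurs at j.  Hence |𝒞|, |𝒰| ≤ |E| and |𝒢| ≤ 3|E|.
-- Conversely E ⊆ 𝒞 × 𝒰, and an edge marked by j is the substring of S of some length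
-- ℓ ≤ k starting at j − a for some a < k, so also |E| ≤ |𝒞| k².
-- Without decidable equality on the alphabet, ≡ₖ is undecidable and the least element of a
-- class exists only under double negation; this is harmless since ≤ on ℕ is decidable.
module Submission where

open import Defs
open import Data.Nat using (ℕ; _+_; _*_; _≤_; _⊓_)
open import Data.List using (List)
open import Data.Product using (Σ; _×_)

open import Data.Bool using (true; false; T)
open import Data.List
  using ([]; _∷_; _++_; [_]; length; take; drop; map; upTo; cartesianProduct; cartesianProductWith)
open import Data.List.Membership.Propositional using (_∈_)
open import Data.List.Membership.Propositional.Properties
  using (∈-∃++; ∈-++⁻; ∈-++⁺ˡ; ∈-++⁺ʳ; ∈-map⁺; ∈-upTo⁺; ∈-cartesianProduct⁺; ∈-cartesianProductWith⁺)
open import Data.List.Properties using (length-map; length-++; length-++-sucʳ; length-upTo)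
open import Data.List.Relation.Binary.Subset.Propositional using (_⊆_)
open import Data.List.Relation.Unary.All as All using (All)
open import Data.List.Relation.Unary.AllPairs using (_∷_)
open import Data.List.Relation.Unary.Any using (here; there)
open import Data.List.Relation.Unary.Unique.Propositional using (Unique)
open import Data.Maybe.Properties using (just-injective)
open import Data.Nat using (zero; suc; _∸_; _<_; _<ᵇ_; z≤n; s≤s; z<s; _≤?_)
open import Data.Nat.Induction using (<-rec)
open import Data.Nat.Properties
open import Algebra.Properties.CommutativeSemigroup +-commutativeSemigroup using (x∙yz≈y∙xz)
open import Data.Product using (∃-syntax; _,_; proj₁; proj₂)
open import Data.Sum using (inj₁; inj₂)
open import Function.Bundles using (module Equivalence)
open import Level using (Level)
open import Relation.Binary.Core using (Rel)
open import Relation.Binary.Definitions using (Reflexive; Transitive)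
open import Relation.Binary.PropositionalEquality hiding ([_])
open import Relation.Nullary using (¬_)
open import Relation.Nullary.Decidable using (decidable-stable)
open import Relation.Nullary.Negation using (contradiction; ¬¬-map; ¬¬-Monad)
open Equivalence using (to; from)

unique⊆⇒length≤ : {X : Set} {xs ys : List X} → Unique xs → xs ⊆ ys → length xs ≤ length ys
unique⊆⇒length≤ {xs = []}     _                 _     = z≤n
unique⊆⇒length≤ {xs = x ∷ xs} (x∉xs ∷ unique) xs⊆ys with ∈-∃++ (xs⊆ys (here refl))
... | ys₁ , ys₂ , refl = begin
  suc (length xs)            ≤⟨ s≤s (unique⊆⇒length≤ unique xs⊆ys₁++ys₂) ⟩
  suc (length (ys₁ ++ ys₂))  ≡⟨ length-++-sucʳ ys₁ x ys₂ ⟨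
  length (ys₁ ++ x ∷ ys₂)    ∎
  where
  open ≤-Reasoning
  xs⊆ys₁++ys₂ : xs ⊆ ys₁ ++ ys₂
  xs⊆ys₁++ys₂ y∈xs with ∈-++⁻ ys₁ (xs⊆ys (there y∈xs))
  ... | inj₁ y∈ys₁         = ∈-++⁺ˡ y∈ys₁
  ... | inj₂ (here refl)   = contradiction refl (All.lookup x∉xs y∈xs)
  ... | inj₂ (there y∈ys₂) = ∈-++⁺ʳ ys₁ y∈ys₂

length-cartesianProductWith : {X Y Z : Set} (f : X → Y → Z) (xs : List X) (ys : List Y) →
  length (cartesianProductWith f xs ys) ≡ length xs * length ys
length-cartesianProductWith f []       ys = refl
length-cartesianProductWith f (x ∷ xs) ys = begin
  length (map (f x) ys ++ cartesianProductWith f xs ys)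
    ≡⟨ length-++ (map (f x) ys) ⟩
  length (map (f x) ys) + length (cartesianProductWith f xs ys)
    ≡⟨ cong₂ _+_ (length-map (f x) ys) (length-cartesianProductWith f xs ys) ⟩
  length ys + length xs * length ys
    ∎
  where open ≡-Reasoning

size≤length : {X : Set} {P : X → Set} {m : ℕ} {ys : List X} →
  HasSize P m → (∀ {x} → P x → x ∈ ys) → m ≤ length ys
size≤length (xs , unique , refl , P⇔∈xs) P⊆ys =
  unique⊆⇒length≤ unique (λ {x} x∈xs → P⊆ys (from (P⇔∈xs x) x∈xs))

¬¬-image⇒size≤ : {X Y : Set} {P : X → Set} {Q : Y → Set} {m n : ℕ} (f : Y → X) →
  HasSize P m → HasSize Q n → (∀ {x} → P x → ¬ ¬ (∃[ y ] Q y × f y ≡ x)) → m ≤ n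
¬¬-image⇒size≤ {Q = Q} {m = m} f sizeP@(xs , _ , refl , P⇔∈xs) (ys , _ , refl , Q⇔∈ys) covered =
  decidable-stable (m ≤? length ys)
    (¬¬-map bound (All.sequenceM _ ¬¬-Monad (All.tabulate (λ {x} x∈xs →
      ¬¬-map ∈-image (covered (from (P⇔∈xs x) x∈xs))))))
  where
  ∈-image : ∀ {x} → ∃[ y ] Q y × f y ≡ x → x ∈ map f ys
  ∈-image (y , Qy , refl) = ∈-map⁺ f (to (Q⇔∈ys y) Qy)
  bound : All (_∈ map f ys) xs → m ≤ length ys
  bound xs⊆fys = ≤-trans (size≤length sizeP (λ {x} Px → All.lookup xs⊆fys (to (P⇔∈xs x) Px)))
                         (≤-reflexive (length-map f ys))

¬¬-least-related : {ℓ : Level} {R : Rel ℕ ℓ} → Reflexive R → Transitive R → ∀ i →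
  ¬ ¬ (∃[ j ] j ≤ i × R j i × (∀ i′ → i′ < j → ¬ R i′ j))
¬¬-least-related {R = R} R-refl R-trans = <-rec _ step
  where
  step : ∀ i → (∀ {i′} → i′ < i → ¬ ¬ (∃[ j ] j ≤ i′ × R j i′ × (∀ i″ → i″ < j → ¬ R i″ j))) →
    ¬ ¬ (∃[ j ] j ≤ i × R j i × (∀ i′ → i′ < j → ¬ R i′ j))
  step i rec no-least = no-least (i , ≤-refl , R-refl , λ i′ i′<i Ri′i →
    rec i′<i (λ (j , j≤i′ , Rji′ , least) →
      no-least (j , ≤-trans j≤i′ (<⇒≤ i′<i) , R-trans Rji′ Ri′i , least)))

module _ {A : Set} where

  charAt-drop : (S : List A) (i s : ℕ) → charAt (drop i S) s ≡ charAt S (i + s)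
  charAt-drop []      zero    s = refl
  charAt-drop []      (suc i) s = refl
  charAt-drop (_ ∷ S) zero    s = refl
  charAt-drop (_ ∷ S) (suc i) s = charAt-drop S i s

  charAt-take : (S : List A) {n s : ℕ} → s < n → charAt (take n S) s ≡ charAt S s
  charAt-take []      {suc n} {s}     _         = refl
  charAt-take (_ ∷ S) {suc n} {zero}  _         = refl
  charAt-take (_ ∷ S) {suc n} {suc s} (s≤s s<n) = charAt-take S s<n

  charAt-agree⇒take≡ : (S w : List A) → (∀ {s} → s < length w → charAt S s ≡ charAt w s) →
    take (length w) S ≡ w
  charAt-agree⇒take≡ S       []      _     = refl
  charAt-agree⇒take≡ []      (_ ∷ _) agree with () ← agree z<s
  charAt-agree⇒take≡ (a ∷ S) (b ∷ w) agree =
    cong₂ _∷_ (just-injective (agree z<s)) (charAt-agree⇒take≡ S w (λ s<n → agree (s≤s s<n)))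

  Occ⇒charAt : {S w : List A} {i s : ℕ} → Occ S w i → s < length w → charAt S (i + s) ≡ charAt w s
  Occ⇒charAt {S} {w} {i} {s} (_ , occurs) s<|w| = begin
    charAt S (i + s)                      ≡⟨ charAt-drop S i s ⟨
    charAt (drop i S) s                   ≡⟨ charAt-take (drop i S) s<|w| ⟨
    charAt (take (length w) (drop i S)) s ≡⟨ cong (λ u → charAt u s) occurs ⟩
    charAt w s                            ∎
    where open ≡-Reasoning

  Occ-transfer : {S w : List A} {i j : ℕ} → j ≤ i →
    (∀ {s} → s < length w → charAt S (j + s) ≡ charAt S (i + s)) → Occ S w i → Occ S w j
  Occ-transfer {S} {w} {j = j} j≤i agree occ@(i+|w|≤|S| , _) =
    ≤-trans (+-monoˡ-≤ (length w) j≤i) i+|w|≤|S| ,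
    charAt-agree⇒take≡ (drop j S) w (λ {s} s<|w| →
      trans (charAt-drop S j s) (trans (agree s<|w|) (Occ⇒charAt occ s<|w|)))

  occ-singleton : {S : List A} {j : ℕ} → j < length S → ∃[ c ] Occ S [ c ] j
  occ-singleton {a ∷ S} {zero}  _         = a , s≤s z≤n , refl
  occ-singleton {a ∷ S} {suc j} (s≤s j<|S|) with occ-singleton j<|S|
  ... | c , j+1≤|S| , occurs = c , s≤s j+1≤|S| , occurs

  padded-shift : (S : List A) (k′ a : ℕ) → padded S (suc k′) (k′ + a) ≡ charAt S a
  padded-shift S k′ a with (k′ + a) <ᵇ k′ in lt
  ... | true  = contradiction (<ᵇ⇒< (k′ + a) k′ (subst T (sym lt) _)) (≤⇒≯ (m≤m+n k′ a))
  ... | false = cong (charAt S) (m+n∸m≡n k′ a)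

  -- Offset k − 1 + s of the window of ≡ₖ around j is position j + s of S.
  EquivK⇒charAt≡ : (S : List A) {k i j s : ℕ} → 1 ≤ k → s < k → EquivK S k j i →
    charAt S (j + s) ≡ charAt S (i + s)
  EquivK⇒charAt≡ S {suc k′} {i} {j} {s} _ s<k j≡ₖi = begin
    charAt S (j + s)                 ≡⟨ padded-shift S k′ (j + s) ⟨
    padded S (suc k′) (k′ + (j + s)) ≡⟨ cong (padded S (suc k′)) (x∙yz≈y∙xz k′ j s) ⟩
    padded S (suc k′) (j + (k′ + s)) ≡⟨ j≡ₖi (k′ + s) (+-monoʳ-< k′ s<k) ⟩
    padded S (suc k′) (i + (k′ + s)) ≡⟨ cong (padded S (suc k′)) (x∙yz≈y∙xz i k′ s) ⟩
    padded S (suc k′) (k′ + (i + s)) ≡⟨ padded-shift S k′ (i + s) ⟩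
    charAt S (i + s)                 ∎
    where open ≡-Reasoning

module _ {A : Set} (S : List A) where

  window : ℕ → ℕ × ℕ → List A
  window j (a , l) = take (suc l) (drop (j ∸ a) S)

  Marks⇒window : {j : ℕ} {w : List A} → Marks S j w →
    ∃[ a ] ∃[ l ] a < length w × l < length w × window j (a , l) ≡ w
  Marks⇒window {j} {[]}    (i , _ , i≤j , j<i+0) =
    contradiction (subst (j <_) (+-identityʳ i) j<i+0) (≤⇒≯ i≤j)
  Marks⇒window {j} {c ∷ w} (i , (_ , occurs) , i≤j , j<i+|w|) =
    j ∸ i , length w , m<n+o⇒m∸n<o j i j<i+|w| , ≤-refl ,
    trans (cong (λ p → take (suc (length w)) (drop p S)) (m∸[m∸n]≡n i≤j)) occurs

  InE⇒window : {k j : ℕ} {w : List A} → InE S k (j , w) →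
    ∃[ a ] ∃[ l ] a < k × l < k × window j (a , l) ≡ w
  InE⇒window (_ , (_ , |w|≤k) , marks) with Marks⇒window marks
  ... | a , l , a<|w| , l<|w| , occurs =
    a , l , <-≤-trans a<|w| |w|≤k , <-≤-trans l<|w| |w|≤k , occurs

  InC⇒singleton-marked : {k j : ℕ} → 1 ≤ k → InC S k j → ∃[ c ] InE S k (j , [ c ])
  InC⇒singleton-marked {j = j} 1≤k inC@(j<|S| , _) with occ-singleton j<|S|
  ... | c , occ =
    c , inC , (([] , c , refl , inj₁ refl , j , occ) , 1≤k) , j , occ , ≤-refl , m<m+n j z<s

  InU⇒¬¬marked : {k : ℕ} {w : List A} → 1 ≤ k → InU S k w → ¬ ¬ (∃[ j ] InE S k (j , w))
  InU⇒¬¬marked {k} 1≤k inU@((x , c , refl , _ , i , occ) , |w|≤k) =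
    ¬¬-map marked (¬¬-least-related (λ _ _ → refl) (λ r r′ t t< → trans (r t t<) (r′ t t<)) i)
    where
    0<|w| : 0 < length (x ++ [ c ])
    0<|w| = subst (0 <_) (sym (length-++-sucʳ x c [])) z<s
    marked : ∃[ j ] j ≤ i × EquivK S k j i × (∀ i′ → i′ < j → ¬ EquivK S k i′ j) →
      ∃[ j ] InE S k (j , x ++ [ c ])
    marked (j , j≤i , j≡ₖi , least) =
      j , (≤-<-trans j≤i (<-≤-trans (m<m+n i 0<|w|) (proj₁ occ)) , least) , inU ,
      j , occⱼ , ≤-refl , m<m+n j 0<|w|
      where
      occⱼ = Occ-transfer j≤i (λ s<|w| → EquivK⇒charAt≡ S 1≤k (<-≤-trans s<|w| |w|≤k) j≡ₖi) occ

module _ {A : Set} {S : List A} {k : ℕ} where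

  nC≤nE : {nC nE : ℕ} → 1 ≤ k → HasSize (InC S k) nC → HasSize (InE S k) nE → nC ≤ nE
  nC≤nE 1≤k sizeC sizeE = ¬¬-image⇒size≤ proj₁ sizeC sizeE λ inC →
    let _ , inE = InC⇒singleton-marked S 1≤k inC in contradiction (_ , inE , refl)

  nU≤nE : {nU nE : ℕ} → 1 ≤ k → HasSize (InU S k) nU → HasSize (InE S k) nE → nU ≤ nE
  nU≤nE 1≤k sizeU sizeE = ¬¬-image⇒size≤ proj₂ sizeU sizeE λ inU →
    ¬¬-map (λ (_ , inE) → _ , inE , refl) (InU⇒¬¬marked S 1≤k inU)

  nE≤nC*nU : {nC nU nE : ℕ} →
    HasSize (InC S k) nC → HasSize (InU S k) nU → HasSize (InE S k) nE → nE ≤ nC * nU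
  nE≤nC*nU {nE = nE} (xsC , _ , refl , InC⇔∈xsC) (xsU , _ , refl , InU⇔∈xsU) sizeE = begin
    nE                                ≤⟨ size≤length sizeE ∈xsC×xsU ⟩
    length (cartesianProduct xsC xsU) ≡⟨ length-cartesianProductWith _,_ xsC xsU ⟩
    length xsC * length xsU           ∎
    where
    open ≤-Reasoning
    ∈xsC×xsU : ∀ {jw} → InE S k jw → jw ∈ cartesianProduct xsC xsU
    ∈xsC×xsU {j , w} (inC , inU , _) =
      ∈-cartesianProduct⁺ (to (InC⇔∈xsC j) inC) (to (InU⇔∈xsU w) inU)

  nE≤nC*k² : {nC nE : ℕ} → HasSize (InC S k) nC → HasSize (InE S k) nE → nE ≤ nC * (k * k)
  nE≤nC*k² {nE = nE} (xsC , _ , refl , InC⇔∈xsC) sizeE = begin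
    nE                          ≤⟨ size≤length sizeE ∈candidates ⟩
    length candidates           ≡⟨ length-cartesianProductWith _ xsC offsets ⟩
    length xsC * length offsets ≡⟨ cong (length xsC *_) length-offsets ⟩
    length xsC * (k * k)        ∎
    where
    open ≤-Reasoning
    offsets : List (ℕ × ℕ)
    offsets = cartesianProduct (upTo k) (upTo k)
    length-offsets : length offsets ≡ k * k
    length-offsets = trans (length-cartesianProductWith _,_ (upTo k) (upTo k))
                           (cong₂ _*_ (length-upTo k) (length-upTo k))
    candidates : List (ℕ × List A)
    candidates = cartesianProductWith (λ j al → j , window S j al) xsC offsets
    ∈candidates : ∀ {jw} → InE S k jw → jw ∈ candidates
    ∈candidates {j , w} inE@(inC , _) with InE⇒window S inE
    ... | a , l , a<k , l<k , refl =
      ∈-cartesianProductWith⁺ _ (to (InC⇔∈xsC j) inC) (∈-cartesianProduct⁺ (∈-upTo⁺ a<k) (∈-upTo⁺ l<k))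

lemma17 : Σ ℕ λ c₁ → Σ ℕ λ c₂ →
    (A : Set) (S : List A) (k : ℕ) → 1 ≤ k →
    (nC nU nE : ℕ) →
    HasSize (InC S k) nC → HasSize (InU S k) nU → HasSize (InE S k) nE →
    ((nC + nU + nE) ≤ c₁ * nE) × (nE ≤ c₂ * (nC * ((k * k) ⊓ nU)))
lemma17 = 3 , 1 , λ A S k 1≤k nC nU nE sizeC sizeU sizeE →
  let open ≤-Reasoning in
  (begin
    nC + nU + nE       ≤⟨ +-mono-≤ (+-mono-≤ (nC≤nE 1≤k sizeC sizeE) (nU≤nE 1≤k sizeU sizeE))
                                   (≤-reflexive (sym (+-identityʳ nE))) ⟩
    nE + nE + (nE + 0) ≡⟨ +-assoc nE nE (nE + 0) ⟩
    3 * nE             ∎) ,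
  (begin
    nE                          ≤⟨ ⊓-glb (nE≤nC*k² sizeC sizeE) (nE≤nC*nU sizeC sizeU sizeE) ⟩
    (nC * (k * k)) ⊓ (nC * nU)  ≡⟨ *-distribˡ-⊓ nC (k * k) nU ⟨
    nC * ((k * k) ⊓ nU)         ≡⟨ *-identityˡ _ ⟨
    1 * (nC * ((k * k) ⊓ nU))   ∎)
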